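{- Let $G=(V,E,F)$ be a graph with $E\cap F=\emptyset$ and let $u,v\in V$. (1) If there is a chordless path $u,t_1,\dots,t_k,v$ in $(V,E)$ ($k\ge 1$) such that for every $i=1,\dots,k$, either $(u,t_i)$ or $(v,t_i)$ is a forbidden edge, then $(u,v)$ is a forbidden edge. (2) Suppose $(u,v)\in E$. If there is a chordless cycle $u,w,t_1,\dots,t_k,v,u$ in $(V,E)$ ($k\ge1$) such that for every $i=1,\dots,k$, either $(u,t_i)$ or $(v,t_i)$ is a forbidden edge, then $(v,w)$ is a forced edge.
   Context: A graph $G=(V,E,F)$ consists of a vertex set $V$, an edge set $E$ of unordered pairs of vertices, and a set $F$ of unordered pairs of vertices with $E\cap F=\emptyset$. A graph is chordal if every cycle of length at least $4$ has a chord. A proper chordal completion of $G$ is a chordal graph $(V,E_S)$ with $E\subseteq E_S$ and $E_S\cap F=\emptyset$. For a pair $(x,y)\notin E$ of distinct vertices, $(x,y)$ is a forbidden edge if no proper chordal completion of $G$ contains $(x,y)$ (equivalently, $(x,y)\in F$ or the graph $(V,E\cup\{(x,y)\},F)$ has no proper chordal completion). A pair $(x,y)$ is a forced edge if it is contained in every proper chordal completion of $G$. A chordless path (cycle) is a path (cycle) of length at least $4$ for cycles, such that no two nonconsecutive vertices of it are adjacent in $(V,E)$. -}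

module Defs where

open import Data.Nat using (ℕ; zero; suc; _≤_; _+_)
open import Data.Fin using (Fin; toℕ)
open import Data.Bool using (Bool; true; false)
open import Data.Product using (Σ; ∃; _×_; _,_)
open import Data.Sum using (_⊎_)
open import Relation.Binary.PropositionalEquality using (_≡_; _≢_)
open import Relation.Nullary using (¬_)
open import Function.Definitions using (Injective)

-- Vertex set V = Fin n. A set of unordered pairs of distinct vertices is
-- represented by a symmetric, irreflexive Bool-valued relation.
Rel : ℕ → Set
Rel n = Fin n → Fin n → Bool

record IsPairSet {n : ℕ} (R : Rel n) : Set where
  field
    sym  : ∀ x y → R x y ≡ R y x
    irr  : ∀ x → R x x ≡ false

record Graph (n : ℕ) : Set where
  field
    E : Rel n
    F : Rel n
    E-pairs : IsPairSet E
    F-pairs : IsPairSet F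
    disjoint : ∀ x y → E x y ≡ true → F x y ≡ false
open Graph public

CSucc : {m : ℕ} → Fin m → Fin m → Set
CSucc {m} i j = (suc (toℕ i) ≡ toℕ j) ⊎ ((suc (toℕ i) ≡ m) × (toℕ j ≡ 0))

LSucc : {m : ℕ} → Fin m → Fin m → Set
LSucc i j = suc (toℕ i) ≡ toℕ j

IsCycle : {n m : ℕ} → Rel n → (Fin m → Fin n) → Set
IsCycle A c = Injective _≡_ _≡_ c × (∀ i j → CSucc i j → A (c i) (c j) ≡ true)

HasChord : {n m : ℕ} → Rel n → (Fin m → Fin n) → Set
HasChord A c = ∃ λ i → ∃ λ j →
  (i ≢ j) × ¬ CSucc i j × ¬ CSucc j i × (A (c i) (c j) ≡ true)

Chordal : {n : ℕ} → Rel n → Set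
Chordal {n} A = ∀ (m : ℕ) (c : Fin m → Fin n) → 4 ≤ m → IsCycle A c → HasChord A c

ChordlessCycle : {n m : ℕ} → Rel n → (Fin m → Fin n) → Set
ChordlessCycle {m = m} A c =
  4 ≤ m × IsCycle A c × (∀ i j → A (c i) (c j) ≡ true → CSucc i j ⊎ CSucc j i)

ChordlessPath : {n m : ℕ} → Rel n → (Fin m → Fin n) → Set
ChordlessPath A p =
  Injective _≡_ _≡_ p × (∀ i j → LSucc i j → A (p i) (p j) ≡ true)
  × (∀ i j → A (p i) (p j) ≡ true → LSucc i j ⊎ LSucc j i)

record ProperChordalCompletion {n : ℕ} (G : Graph n) : Set where
  field
    S : Rel n
    S-pairs : IsPairSet S
    E⊆S : ∀ x y → E G x y ≡ true → S x y ≡ true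
    S∩F : ∀ x y → S x y ≡ true → F G x y ≡ false
    chordal : Chordal S
open ProperChordalCompletion public

Forbidden : {n : ℕ} → Graph n → Fin n → Fin n → Set
Forbidden G x y =
  (x ≢ y) × (E G x y ≡ false) × ¬ (Σ (ProperChordalCompletion G) λ H → S H x y ≡ true)

Forced : {n : ℕ} → Graph n → Fin n → Fin n → Set
Forced G x y = (H : ProperChordalCompletion G) → S H x y ≡ true

module Submission where

-- Call a vertex x detached (from u and v) in a graph S if S
-- lacks the pair (u,x) or the pair (x,v).  Both parts rest on one fact about
-- an arbitrary chordal graph S containing the edge (u,v):
--
--   S has no simple u–v path of length at least 2 whose interior vertices
--   are all detached.                                    (no-detached-path)
--
-- By strong induction on the length L.  For L = 2 the middle vertex is
-- adjacent to both ends, so it is not detached.  For L ≥ 3 the path closed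
-- by the edge (v,u) is a cycle of length at least 4, hence has a chord (a,b);
-- since (a,b) is not the closing pair (0,L), skipping the path vertices
-- strictly between a and b leaves a shorter detached path of length ≥ 2.
-- Paths are indexed by ℕ, so that skipping is precomposition with an index map.
--
-- Part (1): a proper chordal completion containing (u,v) would contain the
-- given chordless path as a detached path, since no completion contains a
-- forbidden pair.  Part (2): in a completion without (v,w), the chordless
-- cycle minus its edge (v,u) is a detached path (w is detached through the
-- missing (w,v)), contradicting that (u,v) ∈ E lies in the completion.

open import Defs
open import Data.Nat using (ℕ; zero; suc; _≤_; _<_; _+_; z≤n; s≤s; z<s; _≤?_; _≟_)
open import Data.Nat.Properties
open import Data.Nat.Induction using (<-rec)
open import Data.Nat.Tactic.RingSolver using (solve-∀)
open import Data.Fin using (Fin; zero; suc; toℕ; fromℕ; fromℕ<; inject₁; lower₁)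
open import Data.Fin.Properties using (toℕ-injective; toℕ<n; toℕ-fromℕ; toℕ-fromℕ<; inject₁-lower₁)
open import Data.Bool using (true; false)
open import Data.Bool.Properties using (¬-not; not-¬)
open import Data.Product using (Σ; ∃; _×_; _,_; proj₁; proj₂)
open import Data.Sum using (_⊎_; inj₁; inj₂; [_,_]′)
open import Data.Empty using (⊥-elim)
open import Function using (_∘_)
open import Function.Definitions using (Injective)
open import Relation.Nullary using (¬_; yes; no)
open import Relation.Binary using (tri<; tri≈; tri>)
open import Relation.Binary.PropositionalEquality

skip : ℕ → ℕ → ℕ → ℕ
skip a e x with x ≤? a
... | yes _ = x
... | no  _ = x + suc e

skip-low : ∀ {a e x} → x ≤ a → skip a e x ≡ x
skip-low {a} {e} {x} x≤a with x ≤? a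
... | yes _   = refl
... | no  x≰a = ⊥-elim (x≰a x≤a)

skip-high : ∀ {a e x} → a < x → skip a e x ≡ x + suc e
skip-high {a} {e} {x} a<x with x ≤? a
... | yes x≤a = ⊥-elim (<⇒≱ a<x x≤a)
... | no  _   = refl

skip-between : ∀ a e x → x ≤ skip a e x × skip a e x ≤ x + suc e
skip-between a e x with x ≤? a
... | yes _ = ≤-refl , m≤m+n x (suc e)
... | no  _ = m≤m+n x (suc e) , ≤-refl

skip-suc : ∀ {a e x} → x ≢ a → skip a e (suc x) ≡ suc (skip a e x)
skip-suc {a} {e} {x} x≢a with <-cmp x a
... | tri< x<a _ _ = trans (skip-low x<a) (cong suc (sym (skip-low (<⇒≤ x<a))))
... | tri≈ _ x≡a _ = ⊥-elim (x≢a x≡a)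
... | tri> _ _ a<x = trans (skip-high (m<n⇒m<1+n a<x)) (cong suc (sym (skip-high a<x)))

skip-injective : ∀ a e → Injective _≡_ _≡_ (skip a e)
skip-injective a e {x} {y} eq with x ≤? a | y ≤? a
... | yes _   | yes _   = eq
... | no  _   | no  _   = +-cancelʳ-≡ (suc e) x y eq
... | yes x≤a | no  y≰a = ⊥-elim (<-irrefl eq (≤-<-trans x≤a (<-≤-trans (≰⇒> y≰a) (m≤m+n y (suc e)))))
... | no  x≰a | yes y≤a = ⊥-elim (<-irrefl (sym eq) (≤-<-trans y≤a (<-≤-trans (≰⇒> x≰a) (m≤m+n x (suc e)))))

at-least-two : ∀ a r → ¬ (a ≡ 0 × r ≡ 0) → 2 ≤ suc a + r
at-least-two (suc a) r       _        = s≤s (s≤s z≤n)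
at-least-two zero    (suc r) _        = s≤s (s≤s z≤n)
at-least-two zero    zero    not-both = ⊥-elim (not-both (refl , refl))

-- Removing e+1 indices from a path of length a+2+e+r leaves length a+1+r.
shortcut-length : ∀ a e r → suc a + r + suc e ≡ suc (suc a) + e + r
shortcut-length = solve-∀

module _ {n : ℕ} (S : Rel n) (u v : Fin n) where

  Detached : Fin n → Set
  Detached x = S u x ≡ false ⊎ S x v ≡ false

  record DetachedPath (L : ℕ) (f : ℕ → Fin n) : Set where
    field
      start    : f 0 ≡ u
      end      : f L ≡ v
      edge     : ∀ a → a < L → S (f a) (f (suc a)) ≡ true
      simple   : ∀ a b → a ≤ L → b ≤ L → f a ≡ f b → a ≡ b
      detached : ∀ a → 0 < a → a < L → Detached (f a)

  record PathChord (L : ℕ) (f : ℕ → Fin n) : Set where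
    field
      a b      : ℕ
      gap      : suc (suc a) ≤ b
      within   : b ≤ L
      not-ends : ¬ (a ≡ 0 × b ≡ L)
      adjacent : S (f a) (f b) ≡ true

  ShorterDetachedPath : ℕ → Set
  ShorterDetachedPath L = ∃ λ L′ → L′ < L × 2 ≤ L′ × ∃ λ g → DetachedPath L′ g

  -- With a single interior vertex, that vertex is adjacent to both ends.
  no-detached-triangle : ∀ {f} → ¬ DetachedPath 2 f
  no-detached-triangle {f} P =
    [ not-¬ u-f1 , not-¬ f1-v ]′ (detached 1 z<s (s≤s z<s))
    where
    open DetachedPath P
    u-f1 : S u (f 1) ≡ true
    u-f1 = subst (λ x → S x (f 1) ≡ true) start (edge 0 z<s)
    f1-v : S (f 1) v ≡ true
    f1-v = subst (λ y → S (f 1) y ≡ true) end (edge 1 (s≤s z<s))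

  close-cycle : ∀ {L f} → DetachedPath L f → S v u ≡ true →
                IsCycle S (λ (i : Fin (suc L)) → f (toℕ i))
  close-cycle {L} {f} P vu = (λ {i} {j} eq → toℕ-injective (simple _ _ (bound i) (bound j) eq)) , cycle-edge
    where
    open DetachedPath P
    bound : (i : Fin (suc L)) → toℕ i ≤ L
    bound i = ≤-pred (toℕ<n i)
    cycle-edge : ∀ i j → CSucc i j → S (f (toℕ i)) (f (toℕ j)) ≡ true
    cycle-edge i j (inj₁ i→j) rewrite sym i→j =
      edge (toℕ i) (subst (_≤ L) (sym i→j) (bound j))
    cycle-edge i j (inj₂ (i-last , j-first)) rewrite suc-injective i-last | j-first =
      subst₂ (λ x y → S x y ≡ true) (sym end) (sym start) vu

  ordered-chord : ∀ {L f} (i j : Fin (suc L)) → toℕ i < toℕ j → ¬ CSucc i j → ¬ CSucc j i →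
                  S (f (toℕ i)) (f (toℕ j)) ≡ true → PathChord L f
  ordered-chord i j i<j ¬i→j ¬j→i ij = record
    { a = toℕ i ; b = toℕ j
    ; gap = ≤∧≢⇒< i<j (¬i→j ∘ inj₁)
    ; within = ≤-pred (toℕ<n j)
    ; not-ends = λ (i-first , j-last) → ¬j→i (inj₂ (cong suc j-last , i-first))
    ; adjacent = ij }

  cycle-chord : ∀ {L f} → (∀ x y → S x y ≡ S y x) →
                HasChord S (λ (i : Fin (suc L)) → f (toℕ i)) → PathChord L f
  cycle-chord S-sym (i , j , i≢j , ¬i→j , ¬j→i , ij) with <-cmp (toℕ i) (toℕ j)
  ... | tri< i<j _ _ = ordered-chord i j i<j ¬i→j ¬j→i ij
  ... | tri≈ _ i≡j _ = ⊥-elim (i≢j (toℕ-injective i≡j))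
  ... | tri> _ _ j<i = ordered-chord j i j<i ¬j→i ¬i→j (trans (S-sym _ _) ij)

  shortcut : ∀ {L a e f} → a < L → DetachedPath (L + suc e) f →
             S (f a) (f (suc a + suc e)) ≡ true → DetachedPath L (f ∘ skip a e)
  shortcut {L} {a} {e} {f} a<L P chord = record
    { start    = trans (cong f (skip-low {a} {e} z≤n)) start
    ; end      = trans (cong f (skip-high a<L)) end
    ; edge     = edge′
    ; simple   = λ x y x≤L y≤L eq → skip-injective a e (simple _ _ (inside x≤L) (inside y≤L) eq)
    ; detached = λ x 0<x x<L →
        detached (skip a e x) (<-≤-trans 0<x (proj₁ (skip-between a e x))) (inside-strict x<L) }
    where
    open DetachedPath P
    inside : ∀ {x y} → x ≤ y → skip a e x ≤ y + suc e
    inside x≤y = ≤-trans (proj₂ (skip-between a e _)) (+-monoˡ-≤ (suc e) x≤y)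
    inside-strict : ∀ {x y} → x < y → skip a e x < y + suc e
    inside-strict x<y = ≤-<-trans (proj₂ (skip-between a e _)) (+-monoˡ-< (suc e) x<y)
    edge′ : ∀ x → x < L → S (f (skip a e x)) (f (skip a e (suc x))) ≡ true
    edge′ x x<L with x ≟ a
    ... | yes refl = subst₂ (λ p q → S (f p) (f q) ≡ true)
                       (sym (skip-low ≤-refl)) (sym (skip-high ≤-refl)) chord
    ... | no  x≢a = subst (λ q → S (f (skip a e x)) (f q) ≡ true)
                      (sym (skip-suc x≢a)) (edge (skip a e x) (inside-strict x<L))

  chord-shortens : ∀ {L f} → DetachedPath L f → PathChord L f → ShorterDetachedPath L
  chord-shortens {f = f} P record { a = a ; gap = gap ; within = within ; not-ends = not-ends ; adjacent = adjacent }
    with m≤n⇒∃[o]m+o≡n gap | m≤n⇒∃[o]m+o≡n within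
  ... | e , refl | r , refl =
    L′ , subst (L′ <_) lengths (m<m+n L′ z<s) , at-least-two a r not-both ,
    f ∘ skip a e , shortcut (m≤m+n (suc a) r) (subst (λ L → DetachedPath L f) (sym lengths) P)
                            (subst (λ b → S (f a) (f b) ≡ true) (sym (+-suc (suc a) e)) adjacent)
    where
    L′ : ℕ
    L′ = suc a + r
    lengths : L′ + suc e ≡ suc (suc a) + e + r
    lengths = shortcut-length a e r
    not-both : ¬ (a ≡ 0 × r ≡ 0)
    not-both (a≡0 , r≡0) = not-ends (a≡0 , sym (trans (cong (suc (suc a) + e +_) r≡0) (+-identityʳ _)))

module _ {n : ℕ} {S : Rel n} (S-sym : ∀ x y → S x y ≡ S y x) (S-chordal : Chordal S)
         {u v : Fin n} (uv : S u v ≡ true) where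

  no-detached-path : ∀ L → 2 ≤ L → ∀ f → ¬ DetachedPath S u v L f
  no-detached-path = <-rec (λ L → 2 ≤ L → ∀ f → ¬ DetachedPath S u v L f) step
    where
    step : ∀ L → (∀ {L′} → L′ < L → 2 ≤ L′ → ∀ g → ¬ DetachedPath S u v L′ g) →
           2 ≤ L → ∀ f → ¬ DetachedPath S u v L f
    step 1 _ (s≤s ()) _ _
    step 2 _ _ _ P = no-detached-triangle S u v P
    step L@(suc (suc (suc _))) shorter _ f P
      with chord-shortens S u v P
             (cycle-chord S u v S-sym (S-chordal (suc L) (λ i → f (toℕ i)) (s≤s (s≤s (s≤s (s≤s z≤n))))
                                         (close-cycle S u v P (trans (S-sym v u) uv))))
    ... | L′ , L′<L , 2≤L′ , g , Q = shorter L′<L 2≤L′ g Q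

extend : {A : Set} {m : ℕ} → (Fin m → A) → A → ℕ → A
extend {m = zero}  p d _       = d
extend {m = suc m} p d zero    = p zero
extend {m = suc m} p d (suc a) = extend (p ∘ suc) d a

extend-at : {A : Set} {m : ℕ} (p : Fin m → A) (d : A) {a : ℕ} (i : Fin m) → a ≡ toℕ i → extend p d a ≡ p i
extend-at p d zero    refl = refl
extend-at p d (suc i) refl = extend-at (p ∘ suc) d i refl

index : ∀ {L a} → a ≤ L → Fin (suc L)
index a≤L = fromℕ< (s≤s a≤L)

toℕ-index : ∀ {L a} (a≤L : a ≤ L) → toℕ (index a≤L) ≡ a
toℕ-index a≤L = toℕ-fromℕ< (s≤s a≤L)

fin-detached-path : ∀ {n L} {S : Rel n} {u v : Fin n} (p : Fin (suc L) → Fin n) →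
  Injective _≡_ _≡_ p → (∀ i j → LSucc i j → S (p i) (p j) ≡ true) →
  p zero ≡ u → p (fromℕ L) ≡ v →
  (∀ i → 0 < toℕ i → toℕ i < L → Detached S u v (p i)) →
  DetachedPath S u v L (extend p u)
fin-detached-path {L = L} {S} {u} {v} p p-inj p-edge p0 pL p-detached = record
  { start    = p0
  ; end      = trans (extend-at p u (fromℕ L) (sym (toℕ-fromℕ L))) pL
  ; edge     = λ a a<L → subst₂ (λ x y → S x y ≡ true) (sym (at (<⇒≤ a<L))) (sym (at a<L))
                 (p-edge _ _ (trans (cong suc (toℕ-index (<⇒≤ a<L))) (sym (toℕ-index a<L))))
  ; simple   = λ a b a≤L b≤L eq →
                 trans (sym (toℕ-index a≤L))
                   (trans (cong toℕ (p-inj (trans (sym (at a≤L)) (trans eq (at b≤L))))) (toℕ-index b≤L))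
  ; detached = λ a 0<a a<L → subst (Detached S u v) (sym (at (<⇒≤ a<L)))
                 (p-detached _ (subst (0 <_) (sym (toℕ-index (<⇒≤ a<L))) 0<a)
                               (subst (_< L) (sym (toℕ-index (<⇒≤ a<L))) a<L)) }
  where
  at : ∀ {a} (a≤L : a ≤ L) → extend p u a ≡ p (index a≤L)
  at a≤L = extend-at p u (index a≤L) (sym (toℕ-index a≤L))

below-last : ∀ {k} (i : Fin (suc k)) → toℕ i < k → ∃ λ j → inject₁ j ≡ i
below-last i i<k = lower₁ i (>⇒≢ i<k) , inject₁-lower₁ i (>⇒≢ i<k)

forbidden-absent : ∀ {n} {G : Graph n} {x y : Fin n} → Forbidden G x y →
                   (H : ProperChordalCompletion G) → S H x y ≡ false
forbidden-absent (_ , _ , no-completion) H = ¬-not (λ xy → no-completion (H , xy))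

forbidden-detached : ∀ {n} {G : Graph n} {u v x : Fin n} → Forbidden G u x ⊎ Forbidden G v x →
                     (H : ProperChordalCompletion G) → Detached (S H) u v x
forbidden-detached     (inj₁ ux) H = inj₁ (forbidden-absent ux H)
forbidden-detached {v = v} {x} (inj₂ vx) H =
  inj₂ (trans (IsPairSet.sym (S-pairs H) x v) (forbidden-absent vx H))

forbidden-by-path : ∀ {n : ℕ} (G : Graph n) (u v : Fin n) →
  ∀ (k : ℕ) → 1 ≤ k → (p : Fin (2 + k) → Fin n) →
  ChordlessPath (E G) p → p zero ≡ u → p (fromℕ (suc k)) ≡ v →
  (∀ (i : Fin k) → Forbidden G u (p (suc (inject₁ i))) ⊎ Forbidden G v (p (suc (inject₁ i)))) →
  Forbidden G u v
forbidden-by-path G u v k 1≤k p (p-inj , p-edge , p-chordless) p0 pL hyp =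
  u≢v , ¬-not uv∉E , no-completion
  where
  u≢v : u ≢ v
  u≢v u≡v with p-inj (trans p0 (trans u≡v (sym pL)))
  ... | ()
  uv∉E : E G u v ≢ true
  uv∉E uv with p-chordless zero (fromℕ (suc k)) (subst₂ (λ x y → E G x y ≡ true) (sym p0) (sym pL) uv)
  ... | inj₁ 1≡k+1 = <⇒≢ 1≤k (trans (suc-injective 1≡k+1) (toℕ-fromℕ k))
  ... | inj₂ ()
  -- A completion containing (u,v) would contain p as a detached path.
  no-completion : ¬ Σ (ProperChordalCompletion G) (λ H → S H u v ≡ true)
  no-completion (H , uv) =
    no-detached-path (IsPairSet.sym (S-pairs H)) (chordal H) uv (suc k) (s≤s 1≤k) (extend p u)
      (fin-detached-path p p-inj (λ i j i→j → E⊆S H _ _ (p-edge i j i→j)) p0 pL interior)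
    where
    interior : ∀ i → 0 < toℕ i → toℕ i < suc k → Detached (S H) u v (p i)
    interior (suc i) _ (s≤s i<k) with below-last i i<k
    ... | j , refl = forbidden-detached (hyp j) H

forced-by-cycle : ∀ {n : ℕ} (G : Graph n) (u v : Fin n) →
  E G u v ≡ true → ∀ (k : ℕ) → 1 ≤ k → (c : Fin (3 + k) → Fin n) →
  ChordlessCycle (E G) c → c zero ≡ u → (w : Fin n) → c (suc zero) ≡ w →
  c (fromℕ (2 + k)) ≡ v →
  (∀ (i : Fin k) → Forbidden G u (c (suc (suc (inject₁ i)))) ⊎ Forbidden G v (c (suc (suc (inject₁ i))))) →
  Forced G v w
forced-by-cycle G u v uv k _ c (_ , (c-inj , c-edge) , _) c0 w c1 cL hyp H = ¬-not vw-required
  where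
  S-sym : ∀ x y → S H x y ≡ S H y x
  S-sym = IsPairSet.sym (S-pairs H)
  -- Without (v,w), the cycle minus its edge (v,u) is a detached u–v path.
  vw-required : S H v w ≢ false
  vw-required vw-absent =
    no-detached-path S-sym (chordal H) (E⊆S H _ _ uv) (suc (suc k)) (s≤s (s≤s z≤n)) (extend c u)
      (fin-detached-path c c-inj (λ i j i→j → E⊆S H _ _ (c-edge i j (inj₁ i→j))) c0 cL interior)
    where
    interior : ∀ i → 0 < toℕ i → toℕ i < suc (suc k) → Detached (S H) u v (c i)
    interior (suc zero) _ _ = inj₂ (trans (cong (λ x → S H x v) c1) (trans (S-sym w v) vw-absent))
    interior (suc (suc i)) _ (s≤s (s≤s i<k)) with below-last i i<k
    ... | j , refl = forbidden-detached (hyp j) H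

lemma1 : ∀ {n : ℕ} (G : Graph n) (u v : Fin n) →
    (∀ (k : ℕ) → 1 ≤ k → (p : Fin (2 + k) → Fin n) →
      ChordlessPath (E G) p → p zero ≡ u → p (fromℕ (suc k)) ≡ v →
      (∀ (i : Fin k) → Forbidden G u (p (suc (inject₁ i))) ⊎ Forbidden G v (p (suc (inject₁ i)))) →
      Forbidden G u v)
    × (E G u v ≡ true → ∀ (k : ℕ) → 1 ≤ k → (c : Fin (3 + k) → Fin n) →
      ChordlessCycle (E G) c → c zero ≡ u → (w : Fin n) → c (suc zero) ≡ w →
      c (fromℕ (2 + k)) ≡ v →
      (∀ (i : Fin k) → Forbidden G u (c (suc (suc (inject₁ i)))) ⊎ Forbidden G v (c (suc (suc (inject₁ i))))) →
      Forced G v w)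
lemma1 G u v = forbidden-by-path G u v , forced-by-cycle G u v
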